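{- Let $A$ be a real symmetric $n\times n$ matrix with symmetric tropical rank $r$. Choose a real number $M$ smaller than every entry of $A$ and a real number $P$ larger than every entry of $A$, and let $$A' = \begin{pmatrix} A & \mathbf{p} \\ \mathbf{p}^{T} & M \end{pmatrix},$$ where $\mathbf{p}$ is the column vector of length $n$ with all entries equal to $P$. Then $A'$ has symmetric tropical rank $r+1$.
   Context: For an $s\times s$ submatrix of a real symmetric matrix $A$ with row index set $I$ and column index set $J$, each bijection $\rho: I \to J$ gives a monomial $\prod_{i\in I} X_{\{i,\rho(i)\}}$ in commuting variables indexed by unordered pairs (so $X_{i,j}=X_{j,i}$), with value $\sum_{i \in I} A_{i,\rho(i)}$. The submatrix is symmetrically tropically singular if the minimum value is attained by at least two distinct monomials. The symmetric tropical rank of $A$ is the largest $s$ such that $A$ has an $s\times s$ submatrix that is not symmetrically tropically singular. -}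

module Defs where

open import Level using (0ℓ)
open import Data.Nat using (ℕ; suc)
import Data.Nat
open import Data.Fin using (Fin; zero; suc)
open import Data.Fin.Properties using (_≟_)
open import Data.Fin.Permutation using (Permutation′; _⟨$⟩ʳ_)
open import Data.List using (List; filter; length; allFin)
open import Data.Maybe using (Maybe; just; nothing)
import Data.Maybe
open import Data.Sum using (_⊎_)
open import Data.Product using (_×_; ∃; ∃-syntax; Σ-syntax)
open import Relation.Binary.PropositionalEquality using (_≡_)
open import Relation.Nullary using (¬_)
open import Relation.Nullary.Decidable using (_×-dec_; _⊎-dec_)
open import Function.Definitions using (Injective)

record OrderedAbGroup : Set₁ where
  infixl 6 _+_
  infix 4 _≤_ _<_
  field
    Carrier   : Set
    _+_       : Carrier → Carrier → Carrier
    0#        : Carrier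
    -_        : Carrier → Carrier
    _≤_       : Carrier → Carrier → Set
    +-assoc   : ∀ x y z → (x + y) + z ≡ x + (y + z)
    +-comm    : ∀ x y → x + y ≡ y + x
    +-identityˡ : ∀ x → 0# + x ≡ x
    -‿inverseˡ : ∀ x → (- x) + x ≡ 0#
    ≤-refl    : ∀ {x} → x ≤ x
    ≤-trans   : ∀ {x y z} → x ≤ y → y ≤ z → x ≤ z
    ≤-antisym : ∀ {x y} → x ≤ y → y ≤ x → x ≡ y
    ≤-total   : ∀ x y → (x ≤ y) ⊎ (y ≤ x)
    +-monoˡ-≤ : ∀ {x y} z → x ≤ y → x + z ≤ y + z

  _<_ : Carrier → Carrier → Set
  x < y = (x ≤ y) × ¬ (x ≡ y)

-- view of Fin (suc n): nothing for the last index fromℕ n, just i for inject₁ i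
lastCase : ∀ {n} → Fin (suc n) → Maybe (Fin n)
lastCase {ℕ.zero} zero = nothing
lastCase {suc n} zero = just zero
lastCase {suc n} (suc i) = Data.Maybe.map suc (lastCase i)

module _ (G : OrderedAbGroup) where
  open OrderedAbGroup G

  Matrix : ℕ → Set
  Matrix n = Fin n → Fin n → Carrier

  Symmetric : ∀ {n} → Matrix n → Set
  Symmetric {n} A = ∀ i j → A i j ≡ A j i

  sumG : ∀ {s} → (Fin s → Carrier) → Carrier
  sumG {ℕ.zero} f = 0#
  sumG {suc s} f = f zero + sumG (λ k → f (suc k))

  -- An s × s submatrix is given by injective maps rows, cols : Fin s → Fin n
  -- enumerating its row index set I and column index set J.  A bijection
  -- ρ : I → J corresponds to a permutation σ of Fin s, via
  -- ρ (rows k) = cols (σ k).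

  value : ∀ {n s} → Matrix n → (Fin s → Fin n) → (Fin s → Fin n) →
          Permutation′ s → Carrier
  value A rows cols σ = sumG (λ k → A (rows k) (cols (σ ⟨$⟩ʳ k)))

  -- The monomial ∏_k X_{{rows k, cols (σ k)}} in commuting variables
  -- indexed by unordered pairs: its exponent of X_{{a,b}} is the number of
  -- k with {rows k , cols (σ k)} = {a , b} as unordered pairs.
  exponent : ∀ {n s} → (Fin s → Fin n) → (Fin s → Fin n) →
             Permutation′ s → Fin n → Fin n → ℕ
  exponent rows cols σ a b =
    length (filter (λ k → ((rows k ≟ a) ×-dec (cols (σ ⟨$⟩ʳ k) ≟ b))
                          ⊎-dec ((rows k ≟ b) ×-dec (cols (σ ⟨$⟩ʳ k) ≟ a)))
                   (allFin _))

  SameMonomial : ∀ {n s} → (Fin s → Fin n) → (Fin s → Fin n) →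
                 Permutation′ s → Permutation′ s → Set
  SameMonomial rows cols σ τ =
    ∀ a b → exponent rows cols σ a b ≡ exponent rows cols τ a b

  SymTropSingular : ∀ {n s} → Matrix n → (Fin s → Fin n) → (Fin s → Fin n) → Set
  SymTropSingular {s = s} A rows cols =
    Σ[ σ ∈ Permutation′ s ] Σ[ τ ∈ Permutation′ s ]
      (¬ SameMonomial rows cols σ τ)
      × (∀ (π : Permutation′ s) → value A rows cols σ ≤ value A rows cols π)
      × (value A rows cols τ ≡ value A rows cols σ)

  HasNonsingular : ∀ {n} → Matrix n → ℕ → Set
  HasNonsingular {n} A s =
    Σ[ rows ∈ (Fin s → Fin n) ] Σ[ cols ∈ (Fin s → Fin n) ]
      Injective _≡_ _≡_ rows × Injective _≡_ _≡_ cols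
      × ¬ SymTropSingular A rows cols

  SymTropRank : ∀ {n} → Matrix n → ℕ → Set
  SymTropRank A r = HasNonsingular A r × (∀ s → HasNonsingular A s → s Data.Nat.≤ r)

  -- the bordered matrix A' = [[A, p], [pᵀ, M]] with p = (P, …, P)ᵀ;
  -- the new row/column is the last index (fromℕ n), the old indices are inject₁ i
  border : ∀ {n} → Matrix n → Carrier → Carrier → Matrix (suc n)
  border A M P i j with lastCase i | lastCase j
  ... | just a  | just b  = A a b
  ... | just _  | nothing = P
  ... | nothing | just _  = P
  ... | nothing | nothing = M

module Submission where

open import Defs
open import Data.Nat using (ℕ; suc)
open import Data.Fin using (Fin)

open import Level using (0ℓ)
open import Algebra.Bundles using (AbelianGroup; CommutativeMonoid)
open import Algebra.Structures using (IsCommutativeMonoid)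
open import Algebra.Structures.Biased using (isCommutativeMonoidˡ)
import Algebra.Properties.AbelianGroup as AbelianGroupProperties
import Algebra.Properties.CommutativeMonoid.Sum as CommutativeMonoidSum
open import Relation.Binary.Bundles using (Preorder)
import Relation.Binary.Reasoning.Preorder as PreorderReasoning
open import Data.Bool using (true; false; if_then_else_)
open import Data.Bool.Properties using (∨-comm)
open import Data.Fin using (zero; suc; punchOut; inject₁; fromℕ; lower₁; toℕ)
open import Data.Fin.Permutation
  using (Permutation; Permutation′; _⟨$⟩ʳ_; _⟨$⟩ˡ_; _∘ₚ_; remove; insert; transpose;
         inverseʳ; punchIn-permute; remove-insert)
import Data.Fin.Permutation.Components as PC
open import Data.Fin.Properties
  using (_≟_; any?; sequence; punchInᵢ≢i; punchIn-injective; punchIn-punchOut;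
         inject₁-injective; inject₁-lower₁; fromℕ≢inject₁; toℕ-fromℕ; toℕ-injective)
open import Data.List using (filter; length; tabulate)
import Data.Nat as ℕ
import Data.Nat.Properties as ℕ
open import Data.Maybe using (just; nothing)
open import Data.Product using (_×_; _,_; proj₁; proj₂; Σ-syntax; ∃-syntax)
open import Data.Sum using (_⊎_; inj₁; inj₂)
open import Data.Vec.Functional using (removeAt; _∷_)
open import Effect.Monad using (RawMonad)
open import Function using (_∘_; id; _⇔_; mk⇔; Equivalence)
open import Function.Definitions using (Injective)
open import Relation.Binary.PropositionalEquality
  using (_≡_; _≢_; refl; sym; trans; cong; cong₂; subst; subst₂; isEquivalence; module ≡-Reasoning)
open import Relation.Nullary using (Dec; yes; no; does; ¬_; contradiction)
open import Relation.Nullary.Decidable using (_×-dec_; _⊎-dec_; dec-true; dec-false)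
open import Relation.Nullary.Negation using (¬¬-Monad)
open import Relation.Unary using (Pred)

-- Laplace-type expansion: if a row of a square submatrix is constant, its minimal
-- assignments are obtained by completing minimal assignments of the minors along that
-- row, so the submatrix is singular as soon as all these minors are; likewise for a
-- column, and for a single minor at a position (k, c) that every minimal assignment
-- must use.  In the bordered matrix the new row and column are constant equal to P
-- except for the corner M, and M + A i j < P + P makes the corner such a position.
-- Hence a non-singular submatrix of the border of size s + 1 either avoids the new
-- row and column, and is a submatrix of A, or has a non-singular minor of size s
-- avoiding them.  Conversely, adjoining the corner to a non-singular submatrix of A
-- keeps it non-singular, since every minimal assignment of the result uses the corner.

indicator : ∀ {p} {P : Set p} → Dec P → ℕ
indicator P? = if does P? then 1 else 0

samePair? : ∀ {n} (u v a b : Fin n) → Dec (((u ≡ a) × (v ≡ b)) ⊎ ((u ≡ b) × (v ≡ a)))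
samePair? u v a b = ((u ≟ a) ×-dec (v ≟ b)) ⊎-dec ((u ≟ b) ×-dec (v ≟ a))

pairIndicator : ∀ {n} → Fin n → Fin n → Fin n → Fin n → ℕ
pairIndicator a b u v = indicator (samePair? u v a b)

pairIndicator-sym : ∀ {n} (a b u v : Fin n) → pairIndicator a b u v ≡ pairIndicator b a u v
pairIndicator-sym a b u v = cong (if_then 1 else 0) (∨-comm (does ((u ≟ a) ×-dec (v ≟ b))) _)

does-≟-injective : ∀ {m n} {f : Fin n → Fin m} → Injective _≡_ _≡_ f → ∀ x y →
  does (f x ≟ f y) ≡ does (x ≟ y)
does-≟-injective {f = f} f-injective x y with x ≟ y
... | yes refl = dec-true (f x ≟ f x) refl
... | no x≢y = dec-false (f x ≟ f y) (x≢y ∘ f-injective)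

pairIndicator-map : ∀ {m n} {f : Fin n → Fin m} → Injective _≡_ _≡_ f → ∀ a b u v →
  pairIndicator (f a) (f b) (f u) (f v) ≡ pairIndicator a b u v
pairIndicator-map f-injective a b u v
  rewrite does-≟-injective f-injective u a | does-≟-injective f-injective v b
        | does-≟-injective f-injective u b | does-≟-injective f-injective v a = refl

pairIndicator-≢ : ∀ {n} {a u v : Fin n} → u ≢ a → v ≢ a → ∀ b → pairIndicator a b u v ≡ 0
pairIndicator-≢ {a = a} {u} {v} u≢a v≢a b
  rewrite dec-false (u ≟ a) u≢a | dec-false (v ≟ a) v≢a with does (u ≟ b)
... | true  = refl
... | false = refl

insert-at : ∀ {m n} (i : Fin (suc m)) (j : Fin (suc n)) (π : Permutation m n) → insert i j π ⟨$⟩ʳ i ≡ j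
insert-at i j π with i ≟ i
... | yes _ = refl
... | no i≢i = contradiction refl i≢i

transpose-matchˡ : ∀ {n} (i j : Fin n) → PC.transpose i j i ≡ j
transpose-matchˡ i j rewrite dec-true (i ≟ i) refl = refl

transpose-matchʳ : ∀ {n} (i j : Fin n) → PC.transpose i j j ≡ i
transpose-matchʳ i j with j ≟ i
... | yes j≡i = j≡i
... | no _ rewrite dec-true (j ≟ j) refl = refl

transpose-mismatch : ∀ {n} {i j k : Fin n} → k ≢ i → k ≢ j → PC.transpose i j k ≡ k
transpose-mismatch {i = i} {j} {k} k≢i k≢j rewrite dec-false (k ≟ i) k≢i | dec-false (k ≟ j) k≢j = refl

module _ {a} {A : Set a} {n} {f : Fin (suc n) → A} (f-injective : Injective _≡_ _≡_ f) where

  removeAt-injective : ∀ i → Injective _≡_ _≡_ (removeAt f i)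
  removeAt-injective i = punchIn-injective i _ _ ∘ f-injective

  removeAt-≢ : ∀ {i x} → f i ≡ x → ∀ j → removeAt f i j ≢ x
  removeAt-≢ {i} fi≡x j fj≡x = punchInᵢ≢i i j (f-injective (trans fj≡x (sym fi≡x)))

∷-injective-fresh : ∀ {a} {A : Set a} {n} {x : A} {f : Fin n → A} →
  (∀ i → f i ≢ x) → Injective _≡_ _≡_ f → Injective _≡_ _≡_ (x ∷ f)
∷-injective-fresh fresh f-injective {zero}  {zero}  _ = refl
∷-injective-fresh fresh f-injective {zero}  {suc j} x≡fj = contradiction (sym x≡fj) (fresh j)
∷-injective-fresh fresh f-injective {suc i} {zero}  fi≡x = contradiction fi≡x (fresh i)
∷-injective-fresh fresh f-injective {suc i} {suc j} fi≡fj = cong suc (f-injective fi≡fj)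

inject₁-lower : ∀ {n} (x : Fin (suc n)) → x ≢ fromℕ n → ∃[ a ] x ≡ inject₁ a
inject₁-lower {n} x x≢n = lower₁ x n≢x , sym (inject₁-lower₁ x n≢x)
  where
  n≢x : n ≢ toℕ x
  n≢x n≡x = x≢n (toℕ-injective (trans (sym n≡x) (sym (toℕ-fromℕ n))))

lastCase-inject₁ : ∀ {n} (a : Fin n) → lastCase (inject₁ a) ≡ just a
lastCase-inject₁ {suc n} zero = refl
lastCase-inject₁ {suc n} (suc a) rewrite lastCase-inject₁ a = refl

lastCase-fromℕ : ∀ n → lastCase (fromℕ n) ≡ nothing
lastCase-fromℕ ℕ.zero = refl
lastCase-fromℕ (suc n) rewrite lastCase-fromℕ n = refl

¬¬-sequence : ∀ {n} {P : Pred (Fin n) 0ℓ} → (∀ i → ¬ ¬ P i) → ¬ ¬ (∀ i → P i)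
¬¬-sequence = sequence (RawMonad.rawApplicative ¬¬-Monad)

module AssignmentSum {a ℓ} (M : CommutativeMonoid a ℓ) where
  open CommutativeMonoid M using (Carrier; _≈_; _∙_; ∙-congˡ; assoc; setoid)
    renaming (sym to ≈-sym; trans to ≈-trans; reflexive to ≈-reflexive)
  open CommutativeMonoidSum M public using (sum; sum-remove; sum-cong-≗; sum-replicate-zero)
  open import Relation.Binary.Reasoning.Setoid setoid

  sum-remove₂ : ∀ {s} (f : Fin (suc (suc s)) → Carrier) {i j} (i≢j : i ≢ j) →
    sum f ≈ (f i ∙ f j) ∙ sum (removeAt (removeAt f i) (punchOut i≢j))
  sum-remove₂ f {i} {j} i≢j = begin
    sum f                                    ≈⟨ sum-remove {i = i} f ⟩
    f i ∙ sum f∖i                            ≈⟨ ∙-congˡ (sum-remove {i = punchOut i≢j} f∖i) ⟩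
    f i ∙ (f∖i (punchOut i≢j) ∙ sum f∖i∖j)   ≡⟨ cong (λ t → f i ∙ (f t ∙ sum f∖i∖j)) (punchIn-punchOut i≢j) ⟩
    f i ∙ (f j ∙ sum f∖i∖j)                  ≈⟨ ≈-sym (assoc _ _ _) ⟩
    (f i ∙ f j) ∙ sum f∖i∖j                  ∎
    where
    f∖i = removeAt f i
    f∖i∖j = removeAt f∖i (punchOut i≢j)

  assignmentSum : ∀ {X Y : Set} {s} → (X → Y → Carrier) → (Fin s → X) → (Fin s → Y) →
    Permutation′ s → Carrier
  assignmentSum f rows cols π = sum (λ j → f (rows j) (cols (π ⟨$⟩ʳ j)))

  module _ {X Y : Set} {s} (f : X → Y → Carrier) (rows : Fin (suc s) → X) (cols : Fin (suc s) → Y) where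

    assignmentSum-remove : ∀ π k {c} → π ⟨$⟩ʳ k ≡ c →
      assignmentSum f rows cols π ≈
      f (rows k) (cols c) ∙ assignmentSum f (removeAt rows k) (removeAt cols c) (remove k π)
    assignmentSum-remove π k refl = ≈-trans (sum-remove {i = k} (λ j → f (rows j) (cols (π ⟨$⟩ʳ j))))
      (∙-congˡ (≈-reflexive (sum-cong-≗ λ j → cong (f _ ∘ cols) (punchIn-permute π k j))))

    assignmentSum-insert : ∀ k c ς →
      assignmentSum f rows cols (insert k c ς) ≈
      f (rows k) (cols c) ∙ assignmentSum f (removeAt rows k) (removeAt cols c) ς
    assignmentSum-insert k c ς = ≈-trans (assignmentSum-remove (insert k c ς) k (insert-at k c ς))
      (∙-congˡ (≈-reflexive (sum-cong-≗ λ j → cong (f _ ∘ removeAt cols c) (remove-insert k c ς j))))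

module ℕSum = AssignmentSum ℕ.+-0-commutativeMonoid

length-filter-tabulate : ∀ {a p} {A : Set a} {P : Pred A p} (P? : ∀ x → Dec (P x)) {s} (f : Fin s → A) →
  length (filter P? (tabulate f)) ≡ ℕSum.sum (λ i → indicator (P? (f i)))
length-filter-tabulate P? {ℕ.zero} f = refl
length-filter-tabulate P? {suc s} f with does (P? (f zero))
... | true  = cong suc (length-filter-tabulate P? (f ∘ suc))
... | false = length-filter-tabulate P? (f ∘ suc)

module _ (G : OrderedAbGroup) where
  open OrderedAbGroup G

  +-abelianGroup : AbelianGroup 0ℓ 0ℓ
  +-abelianGroup = record
    { Carrier = Carrier
    ; _≈_ = _≡_
    ; _∙_ = _+_
    ; ε = 0#
    ; _⁻¹ = -_
    ; isAbelianGroup = record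
      { isGroup = record
        { isMonoid = IsCommutativeMonoid.isMonoid +-isCommutativeMonoid
        ; inverse = -‿inverseˡ , λ x → trans (+-comm x (- x)) (-‿inverseˡ x)
        ; ⁻¹-cong = cong -_
        }
      ; comm = +-comm
      }
    }
    where
    +-isCommutativeMonoid : IsCommutativeMonoid _≡_ _+_ 0#
    +-isCommutativeMonoid = isCommutativeMonoidˡ record
      { isSemigroup = record
        { isMagma = record { isEquivalence = isEquivalence ; ∙-cong = cong₂ _+_ }
        ; assoc = +-assoc
        }
      ; identityˡ = +-identityˡ
      ; comm = +-comm
      }

  open AbelianGroupProperties +-abelianGroup using (∙-cancelˡ; //-rightDividesʳ)
  module GSum = AssignmentSum (AbelianGroup.commutativeMonoid +-abelianGroup)

  +-monoʳ-≤ : ∀ {x y} z → x ≤ y → z + x ≤ z + y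
  +-monoʳ-≤ {x} {y} z x≤y = subst₂ _≤_ (+-comm x z) (+-comm y z) (+-monoˡ-≤ z x≤y)

  +-cancelʳ-≤ : ∀ {x y} z → x + z ≤ y + z → x ≤ y
  +-cancelʳ-≤ {x} {y} z x+z≤y+z =
    subst₂ _≤_ (//-rightDividesʳ z x) (//-rightDividesʳ z y) (+-monoˡ-≤ (- z) x+z≤y+z)

  +-cancelˡ-≤ : ∀ {x y} z → z + x ≤ z + y → x ≤ y
  +-cancelˡ-≤ {x} {y} z z+x≤z+y = +-cancelʳ-≤ z (subst₂ _≤_ (+-comm z x) (+-comm z y) z+x≤z+y)

  +-mono-<-≤ : ∀ {x y z w} → x < y → z ≤ w → x + z < y + w
  +-mono-<-≤ {x} {y} {z} {w} (x≤y , x≢y) z≤w =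
    ≤-trans (+-monoˡ-≤ z x≤y) (+-monoʳ-≤ y z≤w) ,
    λ x+z≡y+w → x≢y (≤-antisym x≤y (+-cancelʳ-≤ z (subst (y + z ≤_) (sym x+z≡y+w) (+-monoʳ-≤ y z≤w))))

  <-≤-trans : ∀ {x y z} → x < y → y ≤ z → x < z
  <-≤-trans (x≤y , x≢y) y≤z = ≤-trans x≤y y≤z , λ x≡z → x≢y (≤-antisym x≤y (subst (_ ≤_) (sym x≡z) y≤z))

  ≤-preorder : Preorder 0ℓ 0ℓ 0ℓ
  ≤-preorder = record
    { Carrier = Carrier
    ; _≈_ = _≡_
    ; _≲_ = _≤_
    ; isPreorder = record { isEquivalence = isEquivalence ; reflexive = λ { refl → ≤-refl } ; trans = ≤-trans }
    }

  module ≤-Reasoning = PreorderReasoning ≤-preorder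

  argmin : ∀ {m} (f : Fin (suc m) → Carrier) → Σ[ i ∈ Fin (suc m) ] (∀ j → f i ≤ f j)
  argmin {ℕ.zero} f = zero , λ { zero → ≤-refl }
  argmin {suc m} f with argmin (f ∘ suc)
  ... | i , minimal with ≤-total (f zero) (f (suc i))
  ... | inj₁ f0≤fi = zero , λ { zero → ≤-refl ; (suc j) → ≤-trans f0≤fi (minimal j) }
  ... | inj₂ fi≤f0 = suc i , λ { zero → fi≤f0 ; (suc j) → minimal j }

  sumG≡sum : ∀ {s} (f : Fin s → Carrier) → sumG G f ≡ GSum.sum f
  sumG≡sum {ℕ.zero} f = refl
  sumG≡sum {suc s} f = cong (f zero +_) (sumG≡sum (f ∘ suc))

  sumG-<-twoPoint : ∀ {s} {f g : Fin s → Carrier} {i j} (i≢j : i ≢ j) →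
    (∀ l → l ≢ i → l ≢ j → f l ≡ g l) → f i + f j < g i + g j → sumG G f < sumG G g
  sumG-<-twoPoint {suc ℕ.zero} {i = zero} {zero} i≢j = contradiction refl i≢j
  sumG-<-twoPoint {suc (suc _)} {f} {g} {i} {j} i≢j agree fi+fj<gi+gj =
    subst₂ _<_ (sym (split f)) (sym (split g))
      (subst (λ t → f i + f j + rest f < g i + g j + t) rest-agree (+-mono-<-≤ fi+fj<gi+gj ≤-refl))
    where
    rest : (Fin _ → Carrier) → Carrier
    rest h = GSum.sum (removeAt (removeAt h i) (punchOut i≢j))
    split : ∀ h → sumG G h ≡ h i + h j + rest h
    split h = trans (sumG≡sum h) (GSum.sum-remove₂ h i≢j)
    rest-agree : rest f ≡ rest g
    rest-agree = GSum.sum-cong-≗ λ l → agree _ (punchInᵢ≢i i _) λ e →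
      punchInᵢ≢i _ l (punchIn-injective i _ _ (trans e (sym (punchIn-punchOut i≢j))))

  exponent≡assignmentSum : ∀ {n s} (rows cols : Fin s → Fin n) π a b →
    exponent G rows cols π a b ≡ ℕSum.assignmentSum (pairIndicator a b) rows cols π
  exponent≡assignmentSum {s = s} rows cols π a b =
    length-filter-tabulate (λ k → samePair? (rows k) (cols (π ⟨$⟩ʳ k)) a b) {s} id

  module _ {n s} (rows cols : Fin s → Fin n) (π : Permutation′ s) where

    exponent-sym : ∀ a b → exponent G rows cols π a b ≡ exponent G rows cols π b a
    exponent-sym a b = begin
      exponent G rows cols π a b
        ≡⟨ exponent≡assignmentSum rows cols π a b ⟩
      ℕSum.assignmentSum (pairIndicator a b) rows cols π
        ≡⟨ ℕSum.sum-cong-≗ (λ j → pairIndicator-sym a b (rows j) (cols (π ⟨$⟩ʳ j))) ⟩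
      ℕSum.assignmentSum (pairIndicator b a) rows cols π
        ≡⟨ exponent≡assignmentSum rows cols π b a ⟨
      exponent G rows cols π b a  ∎
      where open ≡-Reasoning

    exponent-outside : ∀ {x} → (∀ j → rows j ≢ x) → (∀ j → cols j ≢ x) → ∀ y → exponent G rows cols π x y ≡ 0
    exponent-outside {x} rows≢x cols≢x y = begin
      exponent G rows cols π x y                          ≡⟨ exponent≡assignmentSum rows cols π x y ⟩
      ℕSum.assignmentSum (pairIndicator x y) rows cols π  ≡⟨ ℕSum.sum-cong-≗ (λ j → pairIndicator-≢ (rows≢x j) (cols≢x _) y) ⟩
      ℕSum.sum {s} (λ _ → 0)                              ≡⟨ ℕSum.sum-replicate-zero s ⟩
      0                                                   ∎
      where open ≡-Reasoning

  value≡assignmentSum : ∀ {n s} (B : Matrix G n) (rows cols : Fin s → Fin n) π →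
    value G B rows cols π ≡ GSum.assignmentSum B rows cols π
  value≡assignmentSum B rows cols π = sumG≡sum (λ j → B (rows j) (cols (π ⟨$⟩ʳ j)))

  module _ {n s} (rows cols : Fin (suc s) → Fin n) {k c : Fin (suc s)} where

    exponent-remove : ∀ π → π ⟨$⟩ʳ k ≡ c → ∀ a b →
      exponent G rows cols π a b ≡
      pairIndicator a b (rows k) (cols c) ℕ.+ exponent G (removeAt rows k) (removeAt cols c) (remove k π) a b
    exponent-remove π πk≡c a b = begin
      exponent G rows cols π a b
        ≡⟨ exponent≡assignmentSum rows cols π a b ⟩
      ℕSum.assignmentSum (pairIndicator a b) rows cols π
        ≡⟨ ℕSum.assignmentSum-remove (pairIndicator a b) rows cols π k πk≡c ⟩
      pairIndicator a b (rows k) (cols c) ℕ.+ ℕSum.assignmentSum (pairIndicator a b) rows′ cols′ (remove k π)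
        ≡⟨ cong (_ ℕ.+_) (exponent≡assignmentSum rows′ cols′ (remove k π) a b) ⟨
      pairIndicator a b (rows k) (cols c) ℕ.+ exponent G rows′ cols′ (remove k π) a b  ∎
      where
      open ≡-Reasoning
      rows′ = removeAt rows k
      cols′ = removeAt cols c

    exponent-insert : ∀ ς a b →
      exponent G rows cols (insert k c ς) a b ≡
      pairIndicator a b (rows k) (cols c) ℕ.+ exponent G (removeAt rows k) (removeAt cols c) ς a b
    exponent-insert ς a b = begin
      exponent G rows cols (insert k c ς) a b
        ≡⟨ exponent≡assignmentSum rows cols (insert k c ς) a b ⟩
      ℕSum.assignmentSum (pairIndicator a b) rows cols (insert k c ς)
        ≡⟨ ℕSum.assignmentSum-insert (pairIndicator a b) rows cols k c ς ⟩
      pairIndicator a b (rows k) (cols c) ℕ.+ ℕSum.assignmentSum (pairIndicator a b) rows′ cols′ ς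
        ≡⟨ cong (_ ℕ.+_) (exponent≡assignmentSum rows′ cols′ ς a b) ⟨
      pairIndicator a b (rows k) (cols c) ℕ.+ exponent G rows′ cols′ ς a b  ∎
      where
      open ≡-Reasoning
      rows′ = removeAt rows k
      cols′ = removeAt cols c

    sameMonomial-remove : ∀ {σ τ} → σ ⟨$⟩ʳ k ≡ c → τ ⟨$⟩ʳ k ≡ c →
      SameMonomial G (removeAt rows k) (removeAt cols c) (remove k σ) (remove k τ) →
      SameMonomial G rows cols σ τ
    sameMonomial-remove {σ} {τ} σk≡c τk≡c same a b =
      trans (exponent-remove σ σk≡c a b) (trans (cong (_ ℕ.+_) (same a b)) (sym (exponent-remove τ τk≡c a b)))

    sameMonomial-insert : ∀ {σ τ} → SameMonomial G rows cols (insert k c σ) (insert k c τ) →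
      SameMonomial G (removeAt rows k) (removeAt cols c) σ τ
    sameMonomial-insert {σ} {τ} same a b = ℕ.+-cancelˡ-≡ (pairIndicator a b (rows k) (cols c)) _ _
      (trans (sym (exponent-insert σ a b)) (trans (same a b) (exponent-insert τ a b)))

  module _ {n s} (B : Matrix G n) (rows cols : Fin (suc s) → Fin n) {k c : Fin (suc s)} where

    value-remove : ∀ π → π ⟨$⟩ʳ k ≡ c →
      value G B rows cols π ≡ B (rows k) (cols c) + value G B (removeAt rows k) (removeAt cols c) (remove k π)
    value-remove π πk≡c = begin
      value G B rows cols π
        ≡⟨ value≡assignmentSum B rows cols π ⟩
      GSum.assignmentSum B rows cols π
        ≡⟨ GSum.assignmentSum-remove B rows cols π k πk≡c ⟩
      B (rows k) (cols c) + GSum.assignmentSum B rows′ cols′ (remove k π)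
        ≡⟨ cong (_ +_) (value≡assignmentSum B rows′ cols′ (remove k π)) ⟨
      B (rows k) (cols c) + value G B rows′ cols′ (remove k π)  ∎
      where
      open ≡-Reasoning
      rows′ = removeAt rows k
      cols′ = removeAt cols c

    value-insert : ∀ ς →
      value G B rows cols (insert k c ς) ≡ B (rows k) (cols c) + value G B (removeAt rows k) (removeAt cols c) ς
    value-insert ς = begin
      value G B rows cols (insert k c ς)
        ≡⟨ value≡assignmentSum B rows cols (insert k c ς) ⟩
      GSum.assignmentSum B rows cols (insert k c ς)
        ≡⟨ GSum.assignmentSum-insert B rows cols k c ς ⟩
      B (rows k) (cols c) + GSum.assignmentSum B rows′ cols′ ς
        ≡⟨ cong (_ +_) (value≡assignmentSum B rows′ cols′ ς) ⟨
      B (rows k) (cols c) + value G B rows′ cols′ ς  ∎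
      where
      open ≡-Reasoning
      rows′ = removeAt rows k
      cols′ = removeAt cols c

  module _ {n} (B : Matrix G n) where

    IsMinimal : ∀ {s} → (Fin s → Fin n) → (Fin s → Fin n) → Permutation′ s → Set
    IsMinimal rows cols σ = ∀ π → value G B rows cols σ ≤ value G B rows cols π

    -- An assignment avoiding the cell (k , c) is strictly improved by exchanging two of
    -- its cells, so every minimal assignment uses (k , c).
    Pivot : ∀ {s} → (Fin (suc s) → Fin n) → (Fin (suc s) → Fin n) → Fin (suc s) → Fin (suc s) → Set
    Pivot rows cols k c = ∀ k′ c′ → k′ ≢ k → c′ ≢ c →
      B (rows k) (cols c) + B (rows k′) (cols c′) < B (rows k) (cols c′) + B (rows k′) (cols c)

    module _ {s} {rows cols : Fin (suc s) → Fin n} {k c : Fin (suc s)} (pivot : Pivot rows cols k c) where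

      pivot-improve : ∀ π → π ⟨$⟩ʳ k ≢ c →
        Σ[ π′ ∈ Permutation′ (suc s) ] (π′ ⟨$⟩ʳ k ≡ c × value G B rows cols π′ < value G B rows cols π)
      pivot-improve π πk≢c = π′ , π′k≡c , sumG-<-twoPoint (k′≢k ∘ sym) unchanged exchange
        where
        k′ = π ⟨$⟩ˡ c
        c′ = π ⟨$⟩ʳ k
        π′ = transpose k k′ ∘ₚ π
        πk′≡c : π ⟨$⟩ʳ k′ ≡ c
        πk′≡c = inverseʳ π
        k′≢k : k′ ≢ k
        k′≢k k′≡k = πk≢c (trans (cong (π ⟨$⟩ʳ_) (sym k′≡k)) πk′≡c)
        π′k≡c : π′ ⟨$⟩ʳ k ≡ c
        π′k≡c = trans (cong (π ⟨$⟩ʳ_) (transpose-matchˡ k k′)) πk′≡c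
        π′k′≡c′ : π′ ⟨$⟩ʳ k′ ≡ c′
        π′k′≡c′ = cong (π ⟨$⟩ʳ_) (transpose-matchʳ k k′)
        unchanged : ∀ l → l ≢ k → l ≢ k′ → B (rows l) (cols (π′ ⟨$⟩ʳ l)) ≡ B (rows l) (cols (π ⟨$⟩ʳ l))
        unchanged l l≢k l≢k′ = cong (λ t → B (rows l) (cols (π ⟨$⟩ʳ t))) (transpose-mismatch l≢k l≢k′)
        exchange : B (rows k) (cols (π′ ⟨$⟩ʳ k)) + B (rows k′) (cols (π′ ⟨$⟩ʳ k′))
                 < B (rows k) (cols c′) + B (rows k′) (cols (π ⟨$⟩ʳ k′))
        exchange rewrite π′k≡c | π′k′≡c′ | πk′≡c = pivot k′ c′ k′≢k πk≢c

      pivot-minimal : ∀ σ → IsMinimal rows cols σ → σ ⟨$⟩ʳ k ≡ c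
      pivot-minimal σ minimal with σ ⟨$⟩ʳ k ≟ c
      ... | yes σk≡c = σk≡c
      ... | no σk≢c with pivot-improve σ σk≢c
      ...   | π′ , _ , (π′≤σ , π′≢σ) = contradiction (≤-antisym π′≤σ (minimal π′)) π′≢σ

      singular-minor : SymTropSingular G B rows cols → SymTropSingular G B (removeAt rows k) (removeAt cols c)
      singular-minor (σ , τ , σ≉τ , σ-minimal , τ≡σ) = remove k σ , remove k τ , σ′≉τ′ , σ′-minimal , τ′≡σ′
        where
        σk≡c : σ ⟨$⟩ʳ k ≡ c
        σk≡c = pivot-minimal σ σ-minimal
        τk≡c : τ ⟨$⟩ʳ k ≡ c
        τk≡c = pivot-minimal τ λ π → subst (_≤ value G B rows cols π) (sym τ≡σ) (σ-minimal π)
        σ′≉τ′ : ¬ SameMonomial G (removeAt rows k) (removeAt cols c) (remove k σ) (remove k τ)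
        σ′≉τ′ = σ≉τ ∘ sameMonomial-remove rows cols {σ = σ} {τ} σk≡c τk≡c
        σ′-minimal : IsMinimal (removeAt rows k) (removeAt cols c) (remove k σ)
        σ′-minimal ρ = +-cancelˡ-≤ _
          (subst₂ _≤_ (value-remove B rows cols σ σk≡c) (value-insert B rows cols ρ) (σ-minimal (insert k c ρ)))
        τ′≡σ′ : value G B (removeAt rows k) (removeAt cols c) (remove k τ)
              ≡ value G B (removeAt rows k) (removeAt cols c) (remove k σ)
        τ′≡σ′ = ∙-cancelˡ _ _ _
          (trans (sym (value-remove B rows cols τ τk≡c)) (trans τ≡σ (value-remove B rows cols σ σk≡c)))

    module _ {s} (rows cols : Fin (suc s) → Fin n) where

      -- A minimal assignment is obtained by completing the best among the minimal
      -- assignments of the minors at the positions (ks i , cs i).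
      singular-expand : ∀ {m} (ks cs : Fin (suc m) → Fin (suc s)) {p} →
        (∀ i → B (rows (ks i)) (cols (cs i)) ≡ p) →
        (∀ π → Σ[ i ∈ Fin (suc m) ] Σ[ π′ ∈ Permutation′ (suc s) ]
                 (π′ ⟨$⟩ʳ ks i ≡ cs i × value G B rows cols π′ ≤ value G B rows cols π)) →
        (∀ i → SymTropSingular G B (removeAt rows (ks i)) (removeAt cols (cs i))) →
        SymTropSingular G B rows cols
      singular-expand {m} ks cs {p} entry dominated singular = extend (singular best)
        where
        minor : ∀ i → Permutation′ s → Carrier
        minor i = value G B (removeAt rows (ks i)) (removeAt cols (cs i))
        σs : ∀ i → Permutation′ s
        σs i = proj₁ (singular i)
        σs-minimal : ∀ i → IsMinimal (removeAt rows (ks i)) (removeAt cols (cs i)) (σs i)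
        σs-minimal i = proj₁ (proj₂ (proj₂ (proj₂ (singular i))))
        best-property : Σ[ i ∈ Fin (suc m) ] (∀ j → minor i (σs i) ≤ minor j (σs j))
        best-property = argmin (λ i → minor i (σs i))
        best = proj₁ best-property
        best-minimal : ∀ i ρ → minor best (σs best) ≤ minor i ρ
        best-minimal i ρ = ≤-trans (proj₂ best-property i) (σs-minimal i ρ)
        value-insert-best : ∀ ς → value G B rows cols (insert (ks best) (cs best) ς) ≡ p + minor best ς
        value-insert-best ς = trans (value-insert B rows cols ς) (cong (_+ minor best ς) (entry best))
        extend : SymTropSingular G B (removeAt rows (ks best)) (removeAt cols (cs best)) → SymTropSingular G B rows cols
        extend (σ , τ , σ≉τ , σ-minimal , τ≡σ) =
          insert (ks best) (cs best) σ , insert (ks best) (cs best) τ ,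
          σ≉τ ∘ sameMonomial-insert rows cols ,
          minimal ,
          trans (value-insert-best τ) (trans (cong (p +_) τ≡σ) (sym (value-insert-best σ)))
          where
          minimal : IsMinimal rows cols (insert (ks best) (cs best) σ)
          minimal π with dominated π
          ... | i , π′ , π′ki≡ci , π′≤π = begin
            value G B rows cols (insert (ks best) (cs best) σ)
              ≡⟨ value-insert-best σ ⟩
            p + minor best σ
              ≲⟨ +-monoʳ-≤ p (≤-trans (σ-minimal (σs best)) (best-minimal i (remove (ks i) π′))) ⟩
            p + minor i (remove (ks i) π′)
              ≡⟨ cong (_+ minor i (remove (ks i) π′)) (entry i) ⟨
            B (rows (ks i)) (cols (cs i)) + minor i (remove (ks i) π′)
              ≡⟨ value-remove B rows cols π′ π′ki≡ci ⟨
            value G B rows cols π′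
              ≲⟨ π′≤π ⟩
            value G B rows cols π  ∎
            where open ≤-Reasoning

      singular-expand-row : ∀ k {p} → (∀ i → B (rows k) (cols i) ≡ p) →
        (∀ i → SymTropSingular G B (removeAt rows k) (removeAt cols i)) →
        SymTropSingular G B rows cols
      singular-expand-row k entry =
        singular-expand (λ _ → k) id entry (λ π → π ⟨$⟩ʳ k , π , refl , ≤-refl)

      singular-expand-col : ∀ c {p} → (∀ i → B (rows i) (cols c) ≡ p) →
        (∀ i → SymTropSingular G B (removeAt rows i) (removeAt cols c)) →
        SymTropSingular G B rows cols
      singular-expand-col c entry =
        singular-expand id (λ _ → c) entry (λ π → π ⟨$⟩ˡ c , π , inverseʳ π , ≤-refl)

      singular-expand-pivot : ∀ {k c} → Pivot rows cols k c →
        SymTropSingular G B (removeAt rows k) (removeAt cols c) →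
        SymTropSingular G B rows cols
      singular-expand-pivot {k} {c} pivot singular =
        singular-expand {m = 0} (λ _ → k) (λ _ → c) (λ _ → refl) dominated (λ _ → singular)
        where
        dominated : ∀ π → Σ[ i ∈ Fin 1 ] Σ[ π′ ∈ Permutation′ (suc s) ]
                      (π′ ⟨$⟩ʳ k ≡ c × value G B rows cols π′ ≤ value G B rows cols π)
        dominated π with π ⟨$⟩ʳ k ≟ c
        ... | yes πk≡c = zero , π , πk≡c , ≤-refl
        ... | no πk≢c with pivot-improve pivot π πk≢c
        ...   | π′ , π′k≡c , (π′≤π , _) = zero , π′ , π′k≡c , π′≤π

  module _ {m n} {f : Fin n → Fin m} {s} {R C : Fin s → Fin m} {R′ C′ : Fin s → Fin n}
           (R≡f∘R′ : ∀ j → R j ≡ f (R′ j)) (C≡f∘C′ : ∀ j → C j ≡ f (C′ j)) where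

    value-relabel : ∀ (B : Matrix G m) (A : Matrix G n) → (∀ a b → B (f a) (f b) ≡ A a b) →
      ∀ π → value G B R C π ≡ value G A R′ C′ π
    value-relabel B A B∘f≡A π = begin
      value G B R C π               ≡⟨ value≡assignmentSum B R C π ⟩
      GSum.assignmentSum B R C π    ≡⟨ GSum.sum-cong-≗ (λ j → trans (cong₂ B (R≡f∘R′ j) (C≡f∘C′ _)) (B∘f≡A _ _)) ⟩
      GSum.assignmentSum A R′ C′ π  ≡⟨ value≡assignmentSum A R′ C′ π ⟨
      value G A R′ C′ π             ∎
      where open ≡-Reasoning

    module _ (f-injective : Injective _≡_ _≡_ f) where

      exponent-relabel : ∀ π a b → exponent G R C π (f a) (f b) ≡ exponent G R′ C′ π a b
      exponent-relabel π a b = begin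
        exponent G R C π (f a) (f b)
          ≡⟨ exponent≡assignmentSum R C π (f a) (f b) ⟩
        ℕSum.assignmentSum (pairIndicator (f a) (f b)) R C π
          ≡⟨ ℕSum.sum-cong-≗ (λ j → trans (cong₂ (pairIndicator (f a) (f b)) (R≡f∘R′ j) (C≡f∘C′ _))
                                          (pairIndicator-map f-injective a b _ _)) ⟩
        ℕSum.assignmentSum (pairIndicator a b) R′ C′ π
          ≡⟨ exponent≡assignmentSum R′ C′ π a b ⟨
        exponent G R′ C′ π a b  ∎
        where open ≡-Reasoning

      exponent-outside-image : ∀ π {x} → ¬ (∃[ a ] f a ≡ x) → ∀ y → exponent G R C π x y ≡ 0
      exponent-outside-image π x∉f = exponent-outside R C π
        (λ j Rj≡x → x∉f (R′ j , trans (sym (R≡f∘R′ j)) Rj≡x))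
        (λ j Cj≡x → x∉f (C′ j , trans (sym (C≡f∘C′ j)) Cj≡x))

      sameMonomial-relabel : ∀ {σ τ} → SameMonomial G R C σ τ ⇔ SameMonomial G R′ C′ σ τ
      sameMonomial-relabel {σ} {τ} = mk⇔ restrict extend
        where
        restrict : SameMonomial G R C σ τ → SameMonomial G R′ C′ σ τ
        restrict same a b =
          trans (sym (exponent-relabel σ a b)) (trans (same (f a) (f b)) (exponent-relabel τ a b))
        extend : SameMonomial G R′ C′ σ τ → SameMonomial G R C σ τ
        extend same x y with any? (λ a → f a ≟ x) | any? (λ b → f b ≟ y)
        ... | yes (a , refl) | yes (b , refl) =
          trans (exponent-relabel σ a b) (trans (same a b) (sym (exponent-relabel τ a b)))
        ... | no x∉f | _ =
          trans (exponent-outside-image σ x∉f y) (sym (exponent-outside-image τ x∉f y))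
        ... | yes _ | no y∉f = begin
          exponent G R C σ x y  ≡⟨ exponent-sym R C σ x y ⟩
          exponent G R C σ y x  ≡⟨ exponent-outside-image σ y∉f x ⟩
          0                     ≡⟨ exponent-outside-image τ y∉f x ⟨
          exponent G R C τ y x  ≡⟨ exponent-sym R C τ x y ⟨
          exponent G R C τ x y  ∎
          where open ≡-Reasoning

      singular-relabel : ∀ (B : Matrix G m) (A : Matrix G n) → (∀ a b → B (f a) (f b) ≡ A a b) →
        SymTropSingular G B R C ⇔ SymTropSingular G A R′ C′
      singular-relabel B A B∘f≡A = mk⇔
        (λ (σ , τ , σ≉τ , σ-minimal , τ≡σ) →
          σ , τ , σ≉τ ∘ Equivalence.from (sameMonomial-relabel {σ} {τ}) ,
          (λ π → subst₂ _≤_ (relabel σ) (relabel π) (σ-minimal π)) ,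
          trans (sym (relabel τ)) (trans τ≡σ (relabel σ)))
        (λ (σ , τ , σ≉τ , σ-minimal , τ≡σ) →
          σ , τ , σ≉τ ∘ Equivalence.to (sameMonomial-relabel {σ} {τ}) ,
          (λ π → subst₂ _≤_ (sym (relabel σ)) (sym (relabel π)) (σ-minimal π)) ,
          trans (relabel τ) (trans τ≡σ (sym (relabel σ))))
        where
        relabel : ∀ π → value G B R C π ≡ value G A R′ C′ π
        relabel = value-relabel B A B∘f≡A

  module _ {n} (A : Matrix G n) (M P : Carrier) where

    border-inject₁ : ∀ a b → border G A M P (inject₁ a) (inject₁ b) ≡ A a b
    border-inject₁ a b rewrite lastCase-inject₁ a | lastCase-inject₁ b = refl

    border-last-last : border G A M P (fromℕ n) (fromℕ n) ≡ M
    border-last-last rewrite lastCase-fromℕ n = refl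

    border-last-row : ∀ x → x ≢ fromℕ n → border G A M P (fromℕ n) x ≡ P
    border-last-row x x≢L with inject₁-lower x x≢L
    ... | b , refl rewrite lastCase-inject₁ b | lastCase-fromℕ n = refl

    border-last-col : ∀ x → x ≢ fromℕ n → border G A M P x (fromℕ n) ≡ P
    border-last-col x x≢L with inject₁-lower x x≢L
    ... | a , refl rewrite lastCase-inject₁ a | lastCase-fromℕ n = refl

    border-pivot : (∀ i j → M < A i j) → (∀ i j → A i j < P) →
      ∀ {s} {rows cols : Fin (suc s) → Fin (suc n)} → Injective _≡_ _≡_ rows → Injective _≡_ _≡_ cols →
      ∀ {k c} → rows k ≡ fromℕ n → cols c ≡ fromℕ n → Pivot (border G A M P) rows cols k c
    border-pivot M<A A<P {rows = rows} {cols} rows-injective cols-injective {k} {c} rows-k cols-c k′ c′ k′≢k c′≢c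
      with inject₁-lower (rows k′) (λ e → k′≢k (rows-injective (trans e (sym rows-k))))
         | inject₁-lower (cols c′) (λ e → c′≢c (cols-injective (trans e (sym cols-c))))
    ... | a , rows-k′ | b , cols-c′
      rewrite rows-k | cols-c | rows-k′ | cols-c′ | border-last-last | border-inject₁ a b
            | border-last-row (inject₁ b) (fromℕ≢inject₁ ∘ sym) | border-last-col (inject₁ a) (fromℕ≢inject₁ ∘ sym)
      = +-mono-<-≤ (<-≤-trans (M<A a b) (proj₁ (A<P a b))) (proj₁ (A<P a b))

  module _ {n r} (A : Matrix G n) {M P : Carrier} (rank : SymTropRank G A r)
           (M<A : ∀ i j → M < A i j) (A<P : ∀ i j → A i j < P) where

    private
      B : Matrix G (suc n)
      B = border G A M P
      L : Fin (suc n)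
      L = fromℕ n

    rank-bound-avoiding-last : ∀ {s} {R C : Fin s → Fin (suc n)} → Injective _≡_ _≡_ R → Injective _≡_ _≡_ C →
      (∀ j → R j ≢ L) → (∀ j → C j ≢ L) → ¬ SymTropSingular G B R C → s ℕ.≤ r
    rank-bound-avoiding-last {R = R} {C} R-injective C-injective R≢L C≢L nonsingular =
      proj₂ rank _ (R′ , C′ , lower-injective R≡R′ R-injective , lower-injective C≡C′ C-injective , nonsingular ∘ extend)
      where
      R′ C′ : Fin _ → Fin n
      R′ j = proj₁ (inject₁-lower (R j) (R≢L j))
      C′ j = proj₁ (inject₁-lower (C j) (C≢L j))
      R≡R′ : ∀ j → R j ≡ inject₁ (R′ j)
      R≡R′ j = proj₂ (inject₁-lower (R j) (R≢L j))
      C≡C′ : ∀ j → C j ≡ inject₁ (C′ j)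
      C≡C′ j = proj₂ (inject₁-lower (C j) (C≢L j))
      lower-injective : ∀ {F : Fin _ → Fin (suc n)} {F′} → (∀ j → F j ≡ inject₁ (F′ j)) →
        Injective _≡_ _≡_ F → Injective _≡_ _≡_ F′
      lower-injective F≡F′ F-injective {i} {j} e = F-injective (trans (F≡F′ i) (trans (cong inject₁ e) (sym (F≡F′ j))))
      extend : SymTropSingular G A R′ C′ → SymTropSingular G B R C
      extend = Equivalence.from (singular-relabel R≡R′ C≡C′ inject₁-injective B A (border-inject₁ A M P))

    rank-bound-expansion : ∀ {s m} {rows cols : Fin (suc s) → Fin (suc n)} →
      Injective _≡_ _≡_ rows → Injective _≡_ _≡_ cols → (ks cs : Fin (suc m) → Fin (suc s)) →
      (∀ i j → removeAt rows (ks i) j ≢ L) → (∀ i j → removeAt cols (cs i) j ≢ L) →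
      ((∀ i → SymTropSingular G B (removeAt rows (ks i)) (removeAt cols (cs i))) → SymTropSingular G B rows cols) →
      ¬ SymTropSingular G B rows cols → s ℕ.≤ r
    rank-bound-expansion rows-injective cols-injective ks cs rows≢L cols≢L expand nonsingular =
      ℕ.≮⇒≥ λ r<s → ¬¬-sequence
        (λ i minor-nonsingular → ℕ.<⇒≱ r<s (rank-bound-avoiding-last
          (removeAt-injective rows-injective (ks i)) (removeAt-injective cols-injective (cs i))
          (rows≢L i) (cols≢L i) minor-nonsingular))
        (nonsingular ∘ expand)

    border-rank-lower : HasNonsingular G B (suc r)
    border-rank-lower with proj₁ rank
    ... | R , C , R-injective , C-injective , nonsingular =
      L ∷ inject₁ ∘ R , L ∷ inject₁ ∘ C , extend-injective R-injective , extend-injective C-injective ,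
      nonsingular ∘ restrict ∘ singular-minor B corner-pivot
      where
      extend-injective : ∀ {F : Fin r → Fin n} → Injective _≡_ _≡_ F → Injective _≡_ _≡_ (L ∷ inject₁ ∘ F)
      extend-injective F-injective = ∷-injective-fresh (λ _ → fromℕ≢inject₁ ∘ sym) (F-injective ∘ inject₁-injective)
      corner-pivot : Pivot B (L ∷ inject₁ ∘ R) (L ∷ inject₁ ∘ C) zero zero
      corner-pivot = border-pivot A M P M<A A<P (extend-injective R-injective) (extend-injective C-injective) refl refl
      restrict : SymTropSingular G B (inject₁ ∘ R) (inject₁ ∘ C) → SymTropSingular G A R C
      restrict = Equivalence.to (singular-relabel {R′ = R} {C′ = C} (λ _ → refl) (λ _ → refl) inject₁-injective B A (border-inject₁ A M P))

    border-rank-upper : ∀ s → HasNonsingular G B s → s ℕ.≤ suc r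
    border-rank-upper ℕ.zero _ = ℕ.z≤n
    border-rank-upper (suc s) (rows , cols , rows-injective , cols-injective , nonsingular)
      with any? (λ j → rows j ≟ L) | any? (λ j → cols j ≟ L)
    ... | no L∉rows | no L∉cols =
      ℕ.m≤n⇒m≤1+n (rank-bound-avoiding-last rows-injective cols-injective
        (λ j e → L∉rows (j , e)) (λ j e → L∉cols (j , e)) nonsingular)
    ... | yes (k , rows-k) | no L∉cols =
      ℕ.s≤s (rank-bound-expansion rows-injective cols-injective (λ _ → k) id
        (λ _ → removeAt-≢ rows-injective rows-k) (λ i j e → L∉cols (_ , e))
        (singular-expand-row B rows cols k λ i →
          trans (cong (λ x → B x (cols i)) rows-k) (border-last-row A M P (cols i) λ e → L∉cols (i , e)))
        nonsingular)
    ... | no L∉rows | yes (c , cols-c) =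
      ℕ.s≤s (rank-bound-expansion rows-injective cols-injective id (λ _ → c)
        (λ i j e → L∉rows (_ , e)) (λ _ → removeAt-≢ cols-injective cols-c)
        (singular-expand-col B rows cols c λ i →
          trans (cong (B (rows i)) cols-c) (border-last-col A M P (rows i) λ e → L∉rows (i , e)))
        nonsingular)
    ... | yes (k , rows-k) | yes (c , cols-c) =
      ℕ.s≤s (rank-bound-expansion {m = 0} rows-injective cols-injective (λ _ → k) (λ _ → c)
        (λ _ → removeAt-≢ rows-injective rows-k) (λ _ → removeAt-≢ cols-injective cols-c)
        (λ singular → singular-expand-pivot B rows cols
          (border-pivot A M P M<A A<P rows-injective cols-injective rows-k cols-c) (singular zero))
        nonsingular)

lemma7 : (G : OrderedAbGroup) → let open OrderedAbGroup G in
    (n r : ℕ) (A : Matrix G n) (M P : Carrier) →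
    Symmetric G A →
    SymTropRank G A r →
    (∀ i j → M < A i j) →
    (∀ i j → A i j < P) →
    SymTropRank G (border G A M P) (suc r)
lemma7 G n r A M P _ rank M<A A<P = border-rank-lower G A rank M<A A<P , border-rank-upper G A rank M<A A<P
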